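{- Let $k\geq 2$ and let $G_k$ be the weighted directed graph defined below for $\ell=2$ (blue edges of weight $-1$, red edges of weight $+1$). Then the maximum weight of a directed path from node $0$ to node $2^k-1$ in $G_k$ is $0$.
   Context: The pruning function $\operatorname{P}_{2}:\mathbb{Z}_{>0}\to\mathbb{Z}_{\geq 0}$: write $m$ in binary, padded on the left with zeros as needed, let $z$ be the position (position $0$ = least significant bit) of the second zero bit counted from the right, let $q = 2^{z}\lfloor m/2^{z}\rfloor$ (i.e. $m$ with all bits to the right of that zero cleared), and set $\operatorname{P}_2(m)=\max(q-1,0)$. For an integer $k\ge 2$, $G_k$ is the weighted directed graph with node set $\{0\}\cup\{2^{k-1}-1,2^{k-1},\ldots,2^k-1\}$ and edges: for each $m$ with $2^{k-1}-1\le m<2^k-1$, a "blue" edge from $m$ to $m+1$ of weight $-1$ and a "red" edge from $\operatorname{P}_2(m)$ to $m$ of weight $+1$. The weight of a path is the sum of the weights of its edges. -}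

module Defs where

open import Data.Nat using (ℕ; zero; suc; _+_; _*_; _∸_; _^_; _≤_; _<_)
open import Data.Nat.Properties using (m^n≢0)
open import Data.Nat.DivMod using (_/_; _%_)
open import Data.Bool using (Bool; true; false; if_then_else_)
open import Data.Nat using (_≡ᵇ_)
open import Data.Integer as ℤ using (ℤ; +_; -[1+_])

-- Position (0 = least significant bit) of the first zero bit of m
-- (if seen = true) or of the second zero bit of m (if seen = false),
-- counting from the right, with m padded on the left with zeros.
-- The first argument is fuel; m + 2 steps always suffice.
zeroPos : ℕ → Bool → ℕ → ℕ
zeroPos zero    seen m = 0
zeroPos (suc f) seen m =
  if (m % 2) ≡ᵇ 0
  then (if seen then 0 else suc (zeroPos f true (m / 2)))
  else suc (zeroPos f seen (m / 2))

secondZeroPos : ℕ → ℕ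
secondZeroPos m = zeroPos (m + 2) false m

P₂ : ℕ → ℕ
P₂ m = (2 ^ z * (m / 2 ^ z)) ∸ 1
  where
  z = secondZeroPos m
  instance
    _ = m^n≢0 2 z

-- The weighted directed graph G_k (for ℓ = 2).
-- Nodes: 0 and 2^(k-1)-1, …, 2^k-1.  Edges, for 2^(k-1)-1 ≤ m < 2^k-1:
--   blue : m → m+1        (weight -1)
--   red  : P₂(m) → m      (weight +1)
data Edge (k : ℕ) : ℕ → ℕ → Set where
  blue : (m : ℕ) → 2 ^ (k ∸ 1) ∸ 1 ≤ m → m < 2 ^ k ∸ 1 → Edge k m (suc m)
  red  : (m : ℕ) → 2 ^ (k ∸ 1) ∸ 1 ≤ m → m < 2 ^ k ∸ 1 → Edge k (P₂ m) m

edgeWeight : ∀ {k u v} → Edge k u v → ℤ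
edgeWeight (blue _ _ _) = -[1+ 0 ]
edgeWeight (red _ _ _)  = + 1

-- Every edge goes from a smaller to a strictly larger node, so these
-- walks never repeat a vertex, i.e. they are exactly the directed paths.
data Path (k : ℕ) : ℕ → ℕ → Set where
  []  : ∀ {u} → Path k u u
  _∷_ : ∀ {u v w} → Edge k u v → Path k v w → Path k u w

pathWeight : ∀ {k u v} → Path k u v → ℤ
pathWeight []       = + 0
pathWeight (e ∷ p)  = edgeWeight e ℤ.+ pathWeight p

-- Give node 0 the potential k and every other node its popcount. A blue edge m → m + 1
-- lowers the popcount by at most one. For a red edge, q - 1 (q as in P₂(m)) has ones in
-- all positions up to the second zero of m, where m has exactly one zero below that
-- position, and loses at most one one above it; so the popcount rises by at least one,
-- and if P₂(m) = 0 the potential k of node 0 exceeds popcount m since m < 2^k - 1. Thus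
-- every path from 0 to 2^k - 1 (whose popcount is k) has weight at most k - k = 0, and
-- the red edge 0 → 2^k - 2 followed by the blue edge 2^k - 2 → 2^k - 1 has weight 0.

module Submission where

open import Defs
open import Data.Nat using (ℕ; _≤_; _^_; _∸_)
open import Data.Integer using (+_) renaming (_≤_ to _≤ℤ_)
open import Data.Product using (Σ; _×_)
open import Relation.Binary.PropositionalEquality using (_≡_)

open import Data.Bool using (Bool; true; false)
open import Data.Nat using (zero; suc; _+_; _*_; _<_; z≤n; s≤s; NonZero)
open import Data.Nat.DivMod using (_/_; _%_; m/n≡1+[m∸n]/n; m≤n⇒[n∸m]%m≡n%m; m/n/o≡m/[n*o]; 0/n≡0; n/1≡n)
open import Data.Nat.Properties
  using (≤-refl; ≤-trans; n≤1+n; m≤n⇒m≤1+n; m≤m+n; +-suc; +-comm; *-assoc; *-zeroʳ; +-identityʳ; m^n≢0)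
open import Data.Integer as ℤ using (-[1+_]; 0ℤ; +≤+; -≤+; -_)
import Data.Integer.Properties as ℤ
open import Data.Product using (_,_; ∃-syntax)
open import Relation.Binary.PropositionalEquality using (refl; sym; trans; cong; cong₂; subst; subst₂; module ≡-Reasoning)

double : ℕ → ℕ
double zero    = zero
double (suc n) = suc (suc (double n))

double≡2* : ∀ n → double n ≡ 2 * n
double≡2* zero    = refl
double≡2* (suc n) = cong suc (trans (cong suc (double≡2* n)) (sym (+-suc n (n + 0))))

n≤double : ∀ n → n ≤ double n
n≤double zero    = z≤n
n≤double (suc n) = s≤s (m≤n⇒m≤1+n (n≤double n))

double-cancel-≤ : ∀ {m n} → double m ≤ double n → m ≤ n
double-cancel-≤ {zero}          _                = z≤n
double-cancel-≤ {suc m} {suc n} (s≤s (s≤s m≤n)) = s≤s (double-cancel-≤ m≤n)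

double-cancel-< : ∀ {m n} → double m < double n → m < n
double-cancel-< {zero}  {suc n} _                = s≤s z≤n
double-cancel-< {suc m} {suc n} (s≤s (s≤s m<n)) = s≤s (double-cancel-< m<n)

double≤suc⇒≤ : ∀ {m n} → double m ≤ suc n → m ≤ n
double≤suc⇒≤ {zero}          _              = z≤n
double≤suc⇒≤ {suc m} {suc n} (s≤s (s≤s le)) = s≤s (≤-trans (n≤double m) le)

double≡suc⇒ : ∀ {n y} → double n ≡ suc y → ∃[ x ] n ≡ suc x × y ≡ suc (double x)
double≡suc⇒ {suc x} refl = x , refl , refl

data Parity : ℕ → Set where
  even : ∀ h → Parity (double h)
  odd  : ∀ h → Parity (suc (double h))

parity : ∀ n → Parity n
parity zero          = even zero
parity (suc zero)    = odd zero
parity (suc (suc n)) with parity n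
... | even h = even (suc h)
... | odd h  = odd (suc h)

suc-suc-/2 : ∀ n → suc (suc n) / 2 ≡ suc (n / 2)
suc-suc-/2 n = m/n≡1+[m∸n]/n {suc (suc n)} {2} (s≤s (s≤s z≤n))

suc-suc-%2 : ∀ n → suc (suc n) % 2 ≡ n % 2
suc-suc-%2 n = m≤n⇒[n∸m]%m≡n%m {2} {suc (suc n)} (s≤s (s≤s z≤n))

double/2 : ∀ n → double n / 2 ≡ n
double/2 zero    = refl
double/2 (suc n) = trans (suc-suc-/2 (double n)) (cong suc (double/2 n))

suc-double/2 : ∀ n → suc (double n) / 2 ≡ n
suc-double/2 zero    = refl
suc-double/2 (suc n) = trans (suc-suc-/2 (suc (double n))) (cong suc (suc-double/2 n))

double%2 : ∀ n → double n % 2 ≡ 0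
double%2 zero    = refl
double%2 (suc n) = trans (suc-suc-%2 (double n)) (double%2 n)

suc-double%2 : ∀ n → suc (double n) % 2 ≡ 1
suc-double%2 zero    = refl
suc-double%2 (suc n) = trans (suc-suc-%2 (suc (double n))) (suc-double%2 n)

allOnes : ℕ → ℕ
allOnes k = 2 ^ k ∸ 1

2^≡suc-allOnes : ∀ k → 2 ^ k ≡ suc (allOnes k)
2^≡suc-allOnes k = sym (suc-∸1 (2 ^ k) {{m^n≢0 2 k}})
  where
  suc-∸1 : ∀ n .{{_ : NonZero n}} → suc (n ∸ 1) ≡ n
  suc-∸1 (suc n) = refl

allOnes-suc : ∀ k → allOnes (suc k) ≡ suc (double (allOnes k))
allOnes-suc k = cong (_∸ 1) (trans (sym (double≡2* (2 ^ k))) (cong double (2^≡suc-allOnes k)))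

-- The first argument is fuel; any f ≥ m gives the popcount of m.
popcountWith : ℕ → ℕ → ℕ
popcountWith zero    m = 0
popcountWith (suc f) m = m % 2 + popcountWith f (m / 2)

popcount : ℕ → ℕ
popcount m = popcountWith m m

popcountWith-double : ∀ f h → popcountWith (suc f) (double h) ≡ popcountWith f h
popcountWith-double f h = cong₂ _+_ (double%2 h) (cong (popcountWith f) (double/2 h))

popcountWith-suc-double : ∀ f h → popcountWith (suc f) (suc (double h)) ≡ suc (popcountWith f h)
popcountWith-suc-double f h = cong₂ _+_ (suc-double%2 h) (cong (popcountWith f) (suc-double/2 h))

popcountWith-0 : ∀ f → popcountWith f 0 ≡ 0
popcountWith-0 zero    = refl
popcountWith-0 (suc f) = popcountWith-0 f

popcountWith-fuel-irrelevant : ∀ {f g} m → m ≤ f → m ≤ g → popcountWith f m ≡ popcountWith g m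
popcountWith-fuel-irrelevant {f} {g} m m≤f m≤g with parity m
... | even zero = trans (popcountWith-0 f) (sym (popcountWith-0 g))
popcountWith-fuel-irrelevant {suc f} {suc g} _ m≤f m≤g | even (suc h) = begin
  popcountWith (suc f) (double (suc h)) ≡⟨ popcountWith-double f (suc h) ⟩
  popcountWith f (suc h)                ≡⟨ popcountWith-fuel-irrelevant (suc h) (double≤suc⇒≤ m≤f) (double≤suc⇒≤ m≤g) ⟩
  popcountWith g (suc h)                ≡⟨ popcountWith-double g (suc h) ⟨
  popcountWith (suc g) (double (suc h)) ∎
  where open ≡-Reasoning
popcountWith-fuel-irrelevant {suc f} {suc g} _ (s≤s m≤f) (s≤s m≤g) | odd h = begin
  popcountWith (suc f) (suc (double h)) ≡⟨ popcountWith-suc-double f h ⟩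
  suc (popcountWith f h)                ≡⟨ cong suc (popcountWith-fuel-irrelevant h (≤-trans (n≤double h) m≤f) (≤-trans (n≤double h) m≤g)) ⟩
  suc (popcountWith g h)                ≡⟨ popcountWith-suc-double g h ⟨
  popcountWith (suc g) (suc (double h)) ∎
  where open ≡-Reasoning

popcount-double : ∀ h → popcount (double h) ≡ popcount h
popcount-double zero    = refl
popcount-double (suc h) =
  trans (popcountWith-double (suc (double h)) (suc h)) (popcountWith-fuel-irrelevant (suc h) (s≤s (n≤double h)) ≤-refl)

popcount-suc-double : ∀ h → popcount (suc (double h)) ≡ suc (popcount h)
popcount-suc-double h =
  trans (popcountWith-suc-double (double h) h) (cong suc (popcountWith-fuel-irrelevant h (n≤double h) ≤-refl))

popcountWith-suc-≤ : ∀ f n → popcountWith f (suc n) ≤ suc (popcountWith f n)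
popcountWith-suc-≤ zero    n = z≤n
popcountWith-suc-≤ (suc f) n with parity n
... | even h rewrite popcountWith-suc-double f h | popcountWith-double f h = ≤-refl
... | odd h  rewrite popcountWith-double f (suc h) | popcountWith-suc-double f h =
  m≤n⇒m≤1+n (popcountWith-suc-≤ f h)

popcount-suc-≤ : ∀ n → popcount (suc n) ≤ suc (popcount n)
popcount-suc-≤ n =
  subst (λ c → popcount (suc n) ≤ suc c) (popcountWith-fuel-irrelevant n (n≤1+n n) ≤-refl) (popcountWith-suc-≤ (suc n) n)

popcount-allOnes : ∀ k → popcount (allOnes k) ≡ k
popcount-allOnes zero    = refl
popcount-allOnes (suc k) =
  trans (cong popcount (allOnes-suc k)) (trans (popcount-suc-double (allOnes k)) (cong suc (popcount-allOnes k)))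

<2^⇒popcount≤ : ∀ k m → m < 2 ^ k → popcount m ≤ k
<2^⇒popcount≤ zero    zero      _ = z≤n
<2^⇒popcount≤ zero    (suc m)   (s≤s ())
<2^⇒popcount≤ (suc k) m m<2^k with parity m | subst (m <_) (sym (double≡2* (2 ^ k))) m<2^k
... | even h | h<  rewrite popcount-double h =
  m≤n⇒m≤1+n (<2^⇒popcount≤ k h (double-cancel-< h<))
... | odd h  | h<  rewrite popcount-suc-double h =
  s≤s (<2^⇒popcount≤ k h (double-cancel-< (≤-trans (n≤1+n _) h<)))

<allOnes⇒popcount< : ∀ k m → m < allOnes k → popcount m < k
<allOnes⇒popcount< zero    m ()
<allOnes⇒popcount< (suc k) m m<1s with parity m | subst (m <_) (allOnes-suc k) m<1s
... | even h | s≤s h≤ rewrite popcount-double h =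
  s≤s (<2^⇒popcount≤ k h (subst (h <_) (sym (2^≡suc-allOnes k)) (s≤s (double-cancel-≤ h≤))))
... | odd h  | s≤s h< rewrite popcount-suc-double h =
  s≤s (<allOnes⇒popcount< k h (double-cancel-< h<))

clearLowBits : ℕ → ℕ → ℕ
clearLowBits z m = 2 ^ z * (m / 2 ^ z)
  where
  instance
    _ = m^n≢0 2 z

clearLowBits-zeroˡ : ∀ m → clearLowBits 0 m ≡ m
clearLowBits-zeroˡ m = trans (+-identityʳ (m / 1)) (n/1≡n m)

clearLowBits-zeroʳ : ∀ z → clearLowBits z 0 ≡ 0
clearLowBits-zeroʳ z = trans (cong (2 ^ z *_) (0/n≡0 (2 ^ z) {{m^n≢0 2 z}})) (*-zeroʳ (2 ^ z))

clearLowBits-suc : ∀ z m → clearLowBits (suc z) m ≡ double (clearLowBits z (m / 2))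
clearLowBits-suc z m = begin
  2 * 2 ^ z * (m / (2 * 2 ^ z))  ≡⟨ *-assoc 2 (2 ^ z) _ ⟩
  2 * (2 ^ z * (m / (2 * 2 ^ z))) ≡⟨ cong (λ q → 2 * (2 ^ z * q)) (m/n/o≡m/[n*o] m 2 (2 ^ z)) ⟨
  2 * clearLowBits z (m / 2)      ≡⟨ double≡2* _ ⟨
  double (clearLowBits z (m / 2)) ∎
  where
  open ≡-Reasoning
  instance
    _ = m^n≢0 2 z
    _ = m^n≢0 2 (suc z)

-- With seen = false and enough fuel this is the q in the definition of P₂.
clearBelowZero : ℕ → Bool → ℕ → ℕ
clearBelowZero f seen m = clearLowBits (zeroPos f seen m) m

clearBelowZero-zeroʳ : ∀ f seen → clearBelowZero f seen 0 ≡ 0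
clearBelowZero-zeroʳ f seen = clearLowBits-zeroʳ (zeroPos f seen 0)

zeroPos-even-seen : ∀ f h → zeroPos (suc f) true (double h) ≡ 0
zeroPos-even-seen f h rewrite double%2 h = refl

zeroPos-even-unseen : ∀ f h → zeroPos (suc f) false (double h) ≡ suc (zeroPos f true h)
zeroPos-even-unseen f h rewrite double%2 h | double/2 h = refl

zeroPos-odd : ∀ f seen h → zeroPos (suc f) seen (suc (double h)) ≡ suc (zeroPos f seen h)
zeroPos-odd f seen h rewrite suc-double%2 h | suc-double/2 h = refl

clearBelowZero-even-seen : ∀ f h → clearBelowZero (suc f) true (double h) ≡ double h
clearBelowZero-even-seen f h rewrite zeroPos-even-seen f h = clearLowBits-zeroˡ (double h)

clearBelowZero-even-unseen : ∀ f h →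
  clearBelowZero (suc f) false (double h) ≡ double (clearBelowZero f true h)
clearBelowZero-even-unseen f h rewrite zeroPos-even-unseen f h =
  trans (clearLowBits-suc z (double h)) (cong (λ n → double (clearLowBits z n)) (double/2 h))
  where
  z = zeroPos f true h

clearBelowZero-odd : ∀ f seen h →
  clearBelowZero (suc f) seen (suc (double h)) ≡ double (clearBelowZero f seen h)
clearBelowZero-odd f seen h rewrite zeroPos-odd f seen h =
  trans (clearLowBits-suc z (suc (double h))) (cong (λ n → double (clearLowBits z n)) (suc-double/2 h))
  where
  z = zeroPos f seen h

clearBelowZero-allOnes : ∀ j f → allOnes j ≤ f → clearBelowZero f true (allOnes j) ≡ 0
clearBelowZero-allOnes zero    f       _ = clearBelowZero-zeroʳ f true
clearBelowZero-allOnes (suc j) f       le with allOnes (suc j) | allOnes-suc j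
clearBelowZero-allOnes (suc j) (suc f) (s≤s le) | _ | refl =
  trans (clearBelowZero-odd f true (allOnes j))
        (cong double (clearBelowZero-allOnes j f (≤-trans (n≤double _) le)))

popcount-clearBelowFirstZero : ∀ f h {y} → h ≤ f → clearBelowZero f true h ≡ suc y → popcount h ≤ popcount y
popcount-clearBelowFirstZero zero    zero    _ ()
popcount-clearBelowFirstZero (suc f) h {y} h≤f eq with parity h
... | even h′ with double≡suc⇒ (trans (sym (clearBelowZero-even-seen f h′)) eq)
...   | g , refl , refl rewrite popcount-double (suc g) | popcount-suc-double g = popcount-suc-≤ g
popcount-clearBelowFirstZero (suc f) _ {y} (s≤s h≤f) eq | odd h
  with double≡suc⇒ (trans (sym (clearBelowZero-odd f true h)) eq)
...   | x , q≡ , refl rewrite popcount-suc-double h | popcount-suc-double x =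
  s≤s (popcount-clearBelowFirstZero f h (≤-trans (n≤double h) h≤f) q≡)

popcount-clearBelowSecondZero : ∀ f m {y} → m ≤ f → clearBelowZero f false m ≡ suc y → suc (popcount m) ≤ popcount y
popcount-clearBelowSecondZero zero    zero    _ ()
popcount-clearBelowSecondZero (suc f) m {y} m≤f eq with parity m
... | even h with double≡suc⇒ (trans (sym (clearBelowZero-even-unseen f h)) eq)
...   | x , q≡ , refl rewrite popcount-double h | popcount-suc-double x =
  s≤s (popcount-clearBelowFirstZero f h (double≤suc⇒≤ m≤f) q≡)
popcount-clearBelowSecondZero (suc f) _ {y} (s≤s m≤f) eq | odd h
  with double≡suc⇒ (trans (sym (clearBelowZero-odd f false h)) eq)
...   | x , q≡ , refl rewrite popcount-suc-double h | popcount-suc-double x =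
  s≤s (popcount-clearBelowSecondZero f h (≤-trans (n≤double h) m≤f) q≡)

popcount-P₂ : ∀ m {x} → P₂ m ≡ suc x → suc (popcount m) ≤ popcount (suc x)
popcount-P₂ m P₂≡ = popcount-clearBelowSecondZero (m + 2) m (m≤m+n m 2) (pred≡suc⇒ P₂≡)
  where
  pred≡suc⇒ : ∀ {n x} → n ∸ 1 ≡ suc x → n ≡ suc (suc x)
  pred≡suc⇒ {suc n} refl = refl

P₂-double-allOnes : ∀ j → P₂ (double (allOnes j)) ≡ 0
P₂-double-allOnes j = begin
  P₂ m                                                 ≡⟨⟩
  clearBelowZero (m + 2) false m ∸ 1                   ≡⟨ cong (λ f → clearBelowZero f false m ∸ 1) (+-comm m 2) ⟩
  clearBelowZero (2 + m) false m ∸ 1                   ≡⟨ cong (_∸ 1) (clearBelowZero-even-unseen (suc m) (allOnes j)) ⟩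
  double (clearBelowZero (suc m) true (allOnes j)) ∸ 1 ≡⟨ cong (λ n → double n ∸ 1) (clearBelowZero-allOnes j (suc m) (m≤n⇒m≤1+n (n≤double _))) ⟩
  0                                                    ∎
  where
  open ≡-Reasoning
  m = double (allOnes j)

zeroWeightPath : ∀ j → Σ (Path (2 + j) 0 (allOnes (2 + j))) (λ p → pathWeight p ≡ + 0)
zeroWeightPath j = subst₂ (λ u v → Σ (Path (2 + j) u v) (λ p → pathWeight p ≡ + 0))
  (P₂-double-allOnes (suc j)) (sym (allOnes-suc (suc j)))
  (red m lower upper ∷ (blue m lower upper ∷ []) , refl)
  where
  m = double (allOnes (suc j))
  lower : allOnes (suc j) ≤ m
  lower = n≤double _
  upper : m < allOnes (2 + j)
  upper = subst (m <_) (sym (allOnes-suc (suc j))) ≤-refl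

potential : ℕ → ℕ → ℕ
potential k zero    = k
potential k (suc n) = popcount (suc n)

potential-blue : ∀ k m → -[1+ 0 ] ℤ.+ + potential k (suc m) ≤ℤ + potential k m
potential-blue k zero    = +≤+ z≤n
potential-blue k (suc n) with popcount (suc (suc n)) | popcount-suc-≤ (suc n)
... | zero    | _        = -≤+
... | suc pop | s≤s pop≤ = +≤+ pop≤

potential-red : ∀ k m → 0 < m → m < allOnes k → + 1 ℤ.+ + potential k m ≤ℤ + potential k (P₂ m)
potential-red k (suc n) _ m<1s with P₂ (suc n) in P₂≡
... | zero  = +≤+ (<allOnes⇒popcount< k (suc n) m<1s)
... | suc x = +≤+ (popcount-P₂ (suc n) P₂≡)

potential-edge : ∀ j {u v} (e : Edge (2 + j) u v) → edgeWeight e ℤ.+ + potential (2 + j) v ≤ℤ + potential (2 + j) u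
potential-edge j (blue m _ _)         = potential-blue (2 + j) m
potential-edge j (red m lower upper) =
  potential-red (2 + j) m (≤-trans (s≤s z≤n) (subst (_≤ m) (allOnes-suc j) lower)) upper

potential-path : ∀ j {u v} (p : Path (2 + j) u v) → pathWeight p ℤ.+ + potential (2 + j) v ≤ℤ + potential (2 + j) u
potential-path j []       = ℤ.≤-reflexive (ℤ.+-identityˡ _)
potential-path j (e ∷ p) = ℤ.≤-trans (ℤ.≤-reflexive (ℤ.+-assoc (edgeWeight e) (pathWeight p) _))
  (ℤ.≤-trans (ℤ.+-monoʳ-≤ (edgeWeight e) (potential-path j p)) (potential-edge j e))

potential-allOnes : ∀ k → potential k (allOnes k) ≡ k
potential-allOnes zero    = refl
potential-allOnes (suc k) = begin
  potential (suc k) (allOnes (suc k)) ≡⟨ cong (potential (suc k)) (allOnes-suc k) ⟩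
  popcount (suc (double (allOnes k))) ≡⟨ cong popcount (allOnes-suc k) ⟨
  popcount (allOnes (suc k))          ≡⟨ popcount-allOnes (suc k) ⟩
  suc k                               ∎
  where open ≡-Reasoning

i+j≤j⇒i≤0 : ∀ i j → i ℤ.+ j ≤ℤ j → i ≤ℤ 0ℤ
i+j≤j⇒i≤0 i j le = begin
  i             ≡⟨ ℤ.+-identityʳ i ⟨
  i ℤ.+ 0ℤ       ≡⟨ cong (λ t → i ℤ.+ t) (ℤ.+-inverseʳ j) ⟨
  i ℤ.+ (j ℤ.- j) ≡⟨ ℤ.+-assoc i j (- j) ⟨
  i ℤ.+ j ℤ.- j   ≤⟨ ℤ.+-monoˡ-≤ (- j) le ⟩
  j ℤ.- j         ≡⟨ ℤ.+-inverseʳ j ⟩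
  0ℤ             ∎
  where open ℤ.≤-Reasoning

mainTheorem10 : (k : ℕ) → 2 ≤ k →
    Σ (Path k 0 (2 ^ k ∸ 1)) (λ p → pathWeight p ≡ + 0)
    × ((p : Path k 0 (2 ^ k ∸ 1)) → pathWeight p ≤ℤ + 0)
mainTheorem10 (suc zero)    (s≤s ())
mainTheorem10 (suc (suc j)) _ = zeroWeightPath j , λ p →
  i+j≤j⇒i≤0 (pathWeight p) (+ (2 + j))
    (subst (λ n → pathWeight p ℤ.+ + n ≤ℤ + (2 + j)) (potential-allOnes (2 + j)) (potential-path j p))
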